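{- Let $p$ be a prime, $V=\mathbb{Z}_p^{2n}$ with $Q(x,y)=\sum_{i=1}^nx_iy_i$, and let $Z,W$ be maximal isotropic direct summands of $V$. Let $R=(Z\cap W)\otimes\frac{\mathbb{Q}_p}{\mathbb{Z}_p}$ and $S=\big(Z\otimes\frac{\mathbb{Q}_p}{\mathbb{Z}_p}\big)\cap\big(W\otimes\frac{\mathbb{Q}_p}{\mathbb{Z}_p}\big)$, both viewed inside $V\otimes\frac{\mathbb{Q}_p}{\mathbb{Z}_p}$. Then the maximal divisible subgroup of $S$ is $R$.
   Context: A maximal isotropic direct summand of $V$ is a direct summand $Z$ (free of rank $n$) with $Q|_Z=0$. Tensor products are over $\mathbb{Z}_p$. -}

module Defs where

open import Level using (0ℓ)
open import Data.Nat as ℕ using (ℕ; zero; suc; _^_)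
open import Data.Nat.Primality using (Prime)
open import Data.Integer as ℤ using (ℤ; +_; _+_; _-_; _*_; -_)
open import Data.Integer.Divisibility.Signed using (_∣_; ∣m∣n⇒∣m+n; ∣m⇒∣-m; ∣n⇒∣m*n; ∣m⇒∣m*n)
open import Data.Integer.Tactic.RingSolver using (solve-∀)
open import Data.Fin using (Fin; zero; suc; _↑ˡ_; _↑ʳ_)
open import Data.Product using (Σ; ∃; ∃-syntax; _×_; _,_)
open import Relation.Unary using (Pred; _∈_; _⊆_)
open import Relation.Binary.PropositionalEquality using (_≡_; subst; sym)

private
  add-id : ∀ a b c d → (a + b) - (c + d) ≡ (a - c) + (b - d)
  add-id = solve-∀
  mul-id : ∀ a b c d → (a * b) - (c * d) ≡ a * (b - d) + (a - c) * d
  mul-id = solve-∀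
  neg-id : ∀ a c → (- a) - (- c) ≡ - (a - c)
  neg-id = solve-∀
  zero-id : (+ 0) - (+ 0) ≡ (+ 0) * (+ 0)
  zero-id = solve-∀

module _ (p : ℕ) where

  pk : ℕ → ℤ
  pk k = + (p ^ k)

  -- The p-adic integers ℤ_p = lim ℤ/p^k ℤ, realised as coherent
  -- sequences of integers x_k (x_k is the residue mod p^k), with
  -- x_{k+1} ≡ x_k (mod p^k).

  record Zp : Set where
    constructor mkZp
    field
      seq    : ℕ → ℤ
      compat : ∀ k → pk k ∣ (seq (suc k) - seq k)
  open Zp public

  _≈p_ : Zp → Zp → Set
  x ≈p y = ∀ k → pk k ∣ (seq x k - seq y k)

  0p : Zp
  0p = mkZp (λ _ → + 0) (λ k → subst (pk k ∣_) (sym zero-id) (∣n⇒∣m*n (+ 0) (∣m⇒∣m*n (+ 0) (Data.Integer.Divisibility.Signed.∣-refl))))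
    where import Data.Integer.Divisibility.Signed

  _+p_ : Zp → Zp → Zp
  x +p y = mkZp (λ k → seq x k + seq y k)
    (λ k → subst (pk k ∣_) (sym (add-id (seq x (suc k)) (seq y (suc k)) (seq x k) (seq y k)))
                 (∣m∣n⇒∣m+n (compat x k) (compat y k)))

  -p_ : Zp → Zp
  -p x = mkZp (λ k → - seq x k)
    (λ k → subst (pk k ∣_) (sym (neg-id (seq x (suc k)) (seq x k))) (∣m⇒∣-m (compat x k)))

  _*p_ : Zp → Zp → Zp
  x *p y = mkZp (λ k → seq x k * seq y k)
    (λ k → subst (pk k ∣_) (sym (mul-id (seq x (suc k)) (seq y (suc k)) (seq x k) (seq y k)))
                 (∣m∣n⇒∣m+n (∣n⇒∣m*n (seq x (suc k)) (compat y k)) (∣m⇒∣m*n (seq y k) (compat x k))))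

  sump : ∀ {m} → (Fin m → Zp) → Zp
  sump {zero}  f = 0p
  sump {suc m} f = f zero +p sump (λ i → f (suc i))

  -- (wrapped in a record so that n is recoverable from the type)
  record V (n : ℕ) : Set where
    constructor vec
    field
      _!_ : Fin (n ℕ.+ n) → Zp
  open V public

  _≈V_ : ∀ {n} → V n → V n → Set
  u ≈V v = ∀ i → (u ! i) ≈p (v ! i)

  0V : ∀ {n} → V n
  0V = vec (λ _ → 0p)

  _+V_ : ∀ {n} → V n → V n → V n
  u +V v = vec (λ i → (u ! i) +p (v ! i))

  _·V_ : ∀ {n} → Zp → V n → V n
  a ·V v = vec (λ i → a *p (v ! i))

  sumV : ∀ {n m} → (Fin m → V n) → V n
  sumV {m = zero}  f = 0V
  sumV {m = suc m} f = f zero +V sumV (λ i → f (suc i))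

  Q : ∀ {n} → V n → Zp
  Q {n} v = sump (λ (i : Fin n) → (v ! (i ↑ˡ n)) *p (v ! (n ↑ʳ i)))

  record IsSubmodule {n} (Z : Pred (V n) 0ℓ) : Set where
    field
      resp  : ∀ {u v} → u ≈V v → u ∈ Z → v ∈ Z
      zero∈ : 0V ∈ Z
      +∈    : ∀ {u v} → u ∈ Z → v ∈ Z → (u +V v) ∈ Z
      ·∈    : ∀ a {v} → v ∈ Z → (a ·V v) ∈ Z

  IsDirectSummand : ∀ {n} → Pred (V n) 0ℓ → Set₁
  IsDirectSummand {n} Z =
    IsSubmodule Z ×
    Σ (Pred (V n) 0ℓ) λ C →
      IsSubmodule C ×
      (∀ v → Σ (V n) λ z → Σ (V n) λ c → z ∈ Z × c ∈ C × v ≈V (z +V c)) ×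
      (∀ v → v ∈ Z → v ∈ C → v ≈V 0V)

  IsFreeOfRank : ∀ {n} → ℕ → Pred (V n) 0ℓ → Set
  IsFreeOfRank {n} r Z =
    Σ (Fin r → V n) λ b →
      (∀ i → b i ∈ Z) ×
      (∀ z → z ∈ Z → Σ (Fin r → Zp) λ a → z ≈V sumV (λ i → a i ·V b i)) ×
      (∀ (a : Fin r → Zp) → sumV (λ i → a i ·V b i) ≈V 0V → ∀ i → a i ≈p 0p)

  IsIsotropic : ∀ {n} → Pred (V n) 0ℓ → Set
  IsIsotropic Z = ∀ v → v ∈ Z → Q v ≈p 0p

  IsMaxIsotropicSummand : ∀ n → Pred (V n) 0ℓ → Set₁
  IsMaxIsotropicSummand n Z = IsDirectSummand Z × IsFreeOfRank n Z × IsIsotropic Z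

  -- ℚ_p/ℤ_p: elements a / p^k (a ∈ ℤ, k ∈ ℕ), modulo ℤ_p.
  -- a/p^k ≈ b/p^l  iff  p^(k+l) ∣ a p^l - b p^k.

  record QZ : Set where
    constructor _/p^_
    field
      num : ℤ
      ex  : ℕ
  open QZ public

  _≈q_ : QZ → QZ → Set
  s ≈q t = pk (ex s ℕ.+ ex t) ∣ (num s * pk (ex t) - num t * pk (ex s))

  0q : QZ
  0q = (+ 0) /p^ 0

  _+q_ : QZ → QZ → QZ
  s +q t = (num s * pk (ex t) + num t * pk (ex s)) /p^ (ex s ℕ.+ ex t)

  -q_ : QZ → QZ
  -q s = (- num s) /p^ ex s

  _·q_ : Zp → QZ → QZ
  x ·q s = (seq x (ex s) * num s) /p^ ex s

  _×q_ : ℕ → QZ → QZ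
  m ×q s = (+ m * num s) /p^ ex s

  -- V ⊗ ℚ_p/ℤ_p = (ℚ_p/ℤ_p)^{2n}

  record VQ (n : ℕ) : Set where
    constructor vecq
    field
      _!q_ : Fin (n ℕ.+ n) → QZ
  open VQ public

  _≈VQ_ : ∀ {n} → VQ n → VQ n → Set
  u ≈VQ v = ∀ i → (u !q i) ≈q (v !q i)

  0VQ : ∀ {n} → VQ n
  0VQ = vecq (λ _ → 0q)

  _+VQ_ : ∀ {n} → VQ n → VQ n → VQ n
  u +VQ v = vecq (λ i → (u !q i) +q (v !q i))

  -VQ_ : ∀ {n} → VQ n → VQ n
  -VQ u = vecq (λ i → -q (u !q i))

  _×VQ_ : ∀ {n} → ℕ → VQ n → VQ n
  m ×VQ u = vecq (λ i → m ×q (u !q i))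

  _⊗_ : ∀ {n} → V n → QZ → VQ n
  v ⊗ t = vecq (λ i → (v ! i) ·q t)

  sumVQ : ∀ {n m} → (Fin m → VQ n) → VQ n
  sumVQ {m = zero}  f = 0VQ
  sumVQ {m = suc m} f = f zero +VQ sumVQ (λ i → f (suc i))

  -- For a submodule Z ⊆ V, (Z ⊗ ℚ_p/ℤ_p) viewed inside V ⊗ ℚ_p/ℤ_p:
  -- the image of Z ⊗ ℚ_p/ℤ_p → V ⊗ ℚ_p/ℤ_p, i.e. all finite sums Σ z_j ⊗ t_j.
  TensorQZ : ∀ {n} → Pred (V n) 0ℓ → Pred (VQ n) 0ℓ
  TensorQZ {n} Z u =
    Σ ℕ λ m → Σ (Fin m → V n) λ zs → Σ (Fin m → QZ) λ ts →
      (∀ j → zs j ∈ Z) × u ≈VQ sumVQ (λ j → zs j ⊗ ts j)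

  _∩_ : ∀ {A : Set} → Pred A 0ℓ → Pred A 0ℓ → Pred A 0ℓ
  (A ∩ B) x = x ∈ A × x ∈ B

  record IsSubgroup {n} (D : Pred (VQ n) 0ℓ) : Set where
    field
      resp  : ∀ {u v} → u ≈VQ v → u ∈ D → v ∈ D
      zero∈ : 0VQ ∈ D
      +∈    : ∀ {u v} → u ∈ D → v ∈ D → (u +VQ v) ∈ D
      -∈    : ∀ {u} → u ∈ D → (-VQ u) ∈ D

  IsDivisible : ∀ {n} → Pred (VQ n) 0ℓ → Set
  IsDivisible D = ∀ (m : ℕ) → ∀ u → u ∈ D → Σ _ λ w → w ∈ D × ((suc m) ×VQ w) ≈VQ u

  IsMaxDivisibleSubgroupOf : ∀ {n} → Pred (VQ n) 0ℓ → Pred (VQ n) 0ℓ → Set₁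
  IsMaxDivisibleSubgroupOf {n} S D =
    IsSubgroup D × D ⊆ S × IsDivisible D ×
    (∀ (D' : Pred (VQ n) 0ℓ) → IsSubgroup D' → D' ⊆ S → IsDivisible D' → D' ⊆ D)

{-# OPTIONS --safe #-}
-- Every element of X ⊗ ℚ_p/ℤ_p (X a submodule) is a pure tensor x ⊗ p^-K, so R is a
-- subgroup of S, and it is divisible because ℚ_p/ℤ_p is. Conversely, let D ⊆ S be
-- divisible and u ∈ D. Successive p-th roots give w_N ∈ D with p^N w_N = u; if p^e kills
-- u, then p^(N+e) kills w_N, and the numerators of the w_N assemble into one v ∈ V with
-- w_N = v ⊗ p^-(N+e). As each w_N lies in Z ⊗ ℚ_p/ℤ_p, v ⊗ p^-M = z ⊗ p^-K with z ∈ Z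
-- for arbitrarily large M. Since Z is a direct summand, the complement part of v is then
-- divisible by every power of p, so v ∈ Z; likewise v ∈ W, and u = v ⊗ p^-e ∈ R.
module Submission where

open import Defs
open import Level using (0ℓ)
open import Data.Nat as ℕ using (ℕ; zero; suc; _≤_)
open import Data.Nat.Properties as ℕ using ()
open import Data.Nat.Divisibility as ℕ using ()
open import Data.Nat.Coprimality using (Coprime; coprime-Bézout; coprime-divisor)
open import Data.Nat.GCD using (module Bézout)
open import Data.Nat.Primality using (Prime; prime⇒irreducible; prime⇒nonTrivial; prime⇒nonZero)
open import Data.Nat.Induction using (<-wellFounded)
open import Induction.WellFounded using (Acc; acc)
open import Data.Integer as ℤ using (ℤ; +_; _+_; _-_; _*_; -_; 0ℤ; 1ℤ)
open import Data.Integer.Properties as ℤ using ()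
open import Data.Integer.Divisibility.Signed
open import Data.Integer.Tactic.RingSolver using (solve-∀)
open import Data.Fin using (Fin; zero; suc)
open import Data.Product using (Σ; _×_; _,_; proj₁; proj₂)
open import Data.Sum using (inj₁; inj₂)
open import Data.Empty using (⊥-elim)
open import Relation.Nullary using (¬_; yes; no)
open import Relation.Binary.Bundles using (Setoid)
open import Relation.Binary.PropositionalEquality
open import Relation.Unary using (Pred; _∈_; _⊆_)
import Relation.Binary.Reasoning.Setoid as SetoidReasoning

∣-respʳ : ∀ {d x y} → x ≡ y → d ∣ x → d ∣ y
∣-respʳ refl d∣x = d∣x

∣-respˡ : ∀ {d d′ x} → d ≡ d′ → d ∣ x → d′ ∣ x
∣-respˡ refl d∣x = d∣x

∣-zero : ∀ {d} → d ∣ 0ℤ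
∣-zero = divides 0ℤ refl

*-mono-∣ : ∀ {a b x y} → a ∣ x → b ∣ y → a * b ∣ x * y
*-mono-∣ {a} {b} {x} a∣x b∣y = ∣-trans (*-monoˡ-∣ b a∣x) (*-monoʳ-∣ x b∣y)

coprime-* : ∀ {c a b} → Coprime c a → Coprime c b → Coprime c (a ℕ.* b)
coprime-* {c} {a} {b} c⊥a c⊥b {d} (d∣c , d∣ab) = c⊥b (d∣c , coprime-divisor d⊥a d∣ab)
  where
  d⊥a : Coprime d a
  d⊥a (e∣d , e∣a) = c⊥a (ℕ.∣-trans e∣d d∣c , e∣a)

coprime-^ : ∀ {c a} → Coprime c a → ∀ k → Coprime c (a ℕ.^ k)
coprime-^ c⊥a zero    (_ , d∣1) = ℕ.∣1⇒≡1 d∣1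
coprime-^ c⊥a (suc k) = coprime-* c⊥a (coprime-^ c⊥a k)

module _ {p : ℕ} (p-prime : Prime p) where

  ∤⇒coprime : ∀ {c} → ¬ p ℕ.∣ c → Coprime c p
  ∤⇒coprime p∤c (d∣c , d∣p) with prime⇒irreducible p-prime d∣p
  ... | inj₁ d≡1 = d≡1
  ... | inj₂ refl = ⊥-elim (p∤c d∣c)

  split-p-power : ∀ N .{{_ : ℕ.NonZero N}} → Σ ℕ λ j → Σ ℕ λ c → N ≡ p ℕ.^ j ℕ.* c × ¬ p ℕ.∣ c
  split-p-power N = go N (<-wellFounded N)
    where
    instance
      p-nonTrivial : ℕ.NonTrivial p
      p-nonTrivial = prime⇒nonTrivial p-prime
    Split : ℕ → Set
    Split N = Σ ℕ λ j → Σ ℕ λ c → N ≡ p ℕ.^ j ℕ.* c × ¬ p ℕ.∣ c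
    go : ∀ N → Acc ℕ._<_ N → .{{_ : ℕ.NonZero N}} → Split N
    go N (acc smaller) with p ℕ.∣? N
    ... | no p∤N = 0 , N , sym (ℕ.+-identityʳ N) , p∤N
    ... | yes p∣N@(ℕ.divides q N≡q*p) with go q (smaller (ℕ.quotient-< p∣N)) {{ℕ.quotient≢0 p∣N}}
    ...   | j , c , q≡p^j*c , p∤c = suc j , c , N≡p^[1+j]*c , p∤c
      where
      N≡p^[1+j]*c : N ≡ p ℕ.^ suc j ℕ.* c
      N≡p^[1+j]*c = begin
        N                       ≡⟨ N≡q*p ⟩
        q ℕ.* p                 ≡⟨ cong (ℕ._* p) q≡p^j*c ⟩
        p ℕ.^ j ℕ.* c ℕ.* p     ≡⟨ ℕ.*-comm (p ℕ.^ j ℕ.* c) p ⟩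
        p ℕ.* (p ℕ.^ j ℕ.* c)   ≡⟨ ℕ.*-assoc p (p ℕ.^ j) c ⟨
        p ℕ.^ suc j ℕ.* c       ∎
        where open ≡-Reasoning

module _ (p : ℕ) {{_ : ℕ.NonZero p}} where

  p^_ : ℕ → ℤ
  p^_ = pk p

  p^-nonZero : ∀ k → ℤ.NonZero (p^ k)
  p^-nonZero k = ℕ.m^n≢0 p k

  p^-+ : ∀ k l → p^ (k ℕ.+ l) ≡ p^ k * p^ l
  p^-+ k l = trans (cong +_ (ℕ.^-distribˡ-+-* p k l)) (ℤ.pos-* (p ℕ.^ k) (p ℕ.^ l))

  p^-suc : ∀ k → p^ suc k ≡ + p * p^ k
  p^-suc k = ℤ.pos-* p (p ℕ.^ k)

  p^-mono : ∀ {k l} → k ≤ l → p^ k ∣ p^ l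
  p^-mono {k} {l} k≤l =
    ∣-respʳ (trans (sym (p^-+ k (l ℕ.∸ k))) (cong p^_ (ℕ.m+[n∸m]≡n k≤l)))
            (∣m⇒∣m*n (p^ (l ℕ.∸ k)) (∣-refl {p^ k}))

  ∣-cancel-p^ : ∀ k {x y} → p^ k * x ∣ p^ k * y → x ∣ y
  ∣-cancel-p^ k = *-cancelˡ-∣ (p^ k) {{p^-nonZero k}}

  seq-compat : ∀ (x : Zp p) {k l} → k ≤ l → p^ k ∣ seq x l - seq x k
  seq-compat x {k} {l} k≤l =
    subst (λ m → p^ k ∣ seq x m - seq x k) (ℕ.m+[n∸m]≡n k≤l) (compat-+ (l ℕ.∸ k))
    where
    x-k : ℕ → ℤ
    x-k m = seq x m - seq x k
    telescope : ∀ a b c → (a - b) + (b - c) ≡ a - c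
    telescope = solve-∀
    compat-+ : ∀ j → p^ k ∣ x-k (k ℕ.+ j)
    compat-+ zero    = ∣-respʳ (sym (trans (cong x-k (ℕ.+-identityʳ k)) (ℤ.+-inverseʳ (seq x k)))) ∣-zero
    compat-+ (suc j) =
      ∣-respʳ (trans (telescope (seq x (suc (k ℕ.+ j))) (seq x (k ℕ.+ j)) (seq x k)) (cong x-k (sym (ℕ.+-suc k j))))
              (∣m∣n⇒∣m+n (∣-trans (p^-mono (ℕ.m≤m+n k j)) (compat x (k ℕ.+ j))) (compat-+ j))

  ∣-seq-lower : ∀ (x : Zp p) {k l} → k ≤ l → p^ k ∣ seq x l → p^ k ∣ seq x k
  ∣-seq-lower x {k} {l} k≤l p^k∣xl =
    ∣-respʳ (cancel (seq x l) (seq x k)) (∣m∣n⇒∣m-n p^k∣xl (seq-compat x k≤l))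
    where
    cancel : ∀ a b → a - (a - b) ≡ b
    cancel = solve-∀

  fromℤ : ℤ → Zp p
  fromℤ c = mkZp (λ _ → c) (λ _ → ∣-respʳ (sym (ℤ.+-inverseʳ c)) ∣-zero)

  divide-p^ : ∀ L (x : Zp p) → p^ L ∣ seq x L → Σ (Zp p) λ r → _≈p_ p x (_*p_ p (fromℤ (p^ L)) r)
  divide-p^ L x p^L∣xL = r , x≈p^Lr
    where
    p^L∣x : ∀ m → p^ L ∣ seq x (L ℕ.+ m)
    p^L∣x m = ∣-respʳ (telescope (seq x (L ℕ.+ m)) (seq x L))
                      (∣m∣n⇒∣m+n (seq-compat x (ℕ.m≤m+n L m)) p^L∣xL)
      where
      telescope : ∀ a b → (a - b) + b ≡ a
      telescope = solve-∀
    q : ℕ → ℤ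
    q m = quotient (p^L∣x m)
    q-eq : ∀ m → seq x (L ℕ.+ m) ≡ q m * p^ L
    q-eq m = _∣_.equality (p^L∣x m)
    q-compat : ∀ m → p^ m ∣ q (suc m) - q m
    q-compat m = ∣-cancel-p^ L (∣-respˡ (p^-+ L m) (∣-respʳ step (compat x (L ℕ.+ m))))
      where
      factor : ∀ a b u → a * u - b * u ≡ u * (a - b)
      factor = solve-∀
      step : seq x (suc (L ℕ.+ m)) - seq x (L ℕ.+ m) ≡ p^ L * (q (suc m) - q m)
      step = trans (cong₂ _-_ (trans (cong (seq x) (sym (ℕ.+-suc L m))) (q-eq (suc m))) (q-eq m))
                   (factor (q (suc m)) (q m) (p^ L))
    r : Zp p
    r = mkZp q q-compat
    x≈p^Lr : _≈p_ p x (_*p_ p (fromℤ (p^ L)) r)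
    x≈p^Lr m = ∣-respʳ (trans (cong (λ t → - (t - seq x m)) (q-eq m)) (rearrange (q m) (p^ L) (seq x m)))
                       (∣m⇒∣-m (seq-compat x (ℕ.m≤n+m m L)))
      where
      rearrange : ∀ a u b → - (a * u - b) ≡ b - u * a
      rearrange = solve-∀

  -- ℚ_p/ℤ_p

  infix 4 _≈_
  infixl 6 _⊕_
  infixr 7 _×ₙ_

  _⊕_ : QZ p → QZ p → QZ p
  _⊕_ = _+q_ p

  _×ₙ_ : ℕ → QZ p → QZ p
  _×ₙ_ = _×q_ p

  -- Opaque, so that both sides of an equation can be read off its type.
  opaque
    _≈_ : QZ p → QZ p → Set
    _≈_ = _≈q_ p

    ≈-intro : ∀ {a k b l} → p^ (k ℕ.+ l) ∣ a * p^ l - b * p^ k → (a /p^ k) ≈ (b /p^ l)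
    ≈-intro h = h

    ≈-elim : ∀ {a k b l} → (a /p^ k) ≈ (b /p^ l) → p^ (k ℕ.+ l) ∣ a * p^ l - b * p^ k
    ≈-elim h = h

    ≈q⇒≈ : ∀ {s t} → _≈q_ p s t → s ≈ t
    ≈q⇒≈ h = h

    ≈⇒≈q : ∀ {s t} → s ≈ t → _≈q_ p s t
    ≈⇒≈q h = h

  ≈-cross : ∀ {a k b l} → a * p^ l ≡ b * p^ k → (a /p^ k) ≈ (b /p^ l)
  ≈-cross {a} {k} {b} {l} eq =
    ≈-intro (∣-respʳ (sym (trans (cong (_- b * p^ k) eq) (ℤ.+-inverseʳ (b * p^ k)))) ∣-zero)

  ∣⇒≈ : ∀ {a b} k → p^ k ∣ a - b → (a /p^ k) ≈ (b /p^ k)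
  ∣⇒≈ {a} {b} k h =
    ≈-intro (∣-respˡ (sym (p^-+ k k)) (∣-respʳ (distrib a b (p^ k)) (*-mono-∣ h (∣-refl {p^ k}))))
    where
    distrib : ∀ a b x → (a - b) * x ≡ a * x - b * x
    distrib = solve-∀

  ≈⇒∣ : ∀ {a b} k → (a /p^ k) ≈ (b /p^ k) → p^ k ∣ a - b
  ≈⇒∣ {a} {b} k h = ∣-cancel-p^ k (∣-respʳ (factor a b (p^ k)) (∣-respˡ (p^-+ k k) (≈-elim h)))
    where
    factor : ∀ a b x → a * x - b * x ≡ x * (a - b)
    factor = solve-∀

  ≈-refl : ∀ {s} → s ≈ s
  ≈-refl = ≈-cross refl

  ≈-sym : ∀ {s t} → s ≈ t → t ≈ s
  ≈-sym {a /p^ k} {b /p^ l} h =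
    ≈-intro (∣-respˡ (cong p^_ (ℕ.+-comm k l)) (∣-respʳ (negate a b (p^ k) (p^ l)) (∣m⇒∣-m (≈-elim h))))
    where
    negate : ∀ a b x y → - (a * y - b * x) ≡ b * x - a * y
    negate = solve-∀

  -- Multiply the two hypotheses by p^m and p^k; their sum is p^l times the goal.
  ≈-trans : ∀ {s t u} → s ≈ t → t ≈ u → s ≈ u
  ≈-trans {a /p^ k} {b /p^ l} {c /p^ m} h₁ h₂ =
    ≈-intro (∣-cancel-p^ l (∣-respˡ divisor (∣-respʳ (combine a b c x y z) (∣m∣n⇒∣m+n t₁ t₂))))
    where
    x y z : ℤ
    x = p^ k
    y = p^ l
    z = p^ m
    t₁ : (x * y) * z ∣ (a * y - b * x) * z
    t₁ = *-monoˡ-∣ z (∣-respˡ (p^-+ k l) (≈-elim h₁))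
    t₂ : (x * y) * z ∣ (b * z - c * y) * x
    t₂ = ∣-respˡ (rotate x y z) (*-monoˡ-∣ x (∣-respˡ (p^-+ l m) (≈-elim h₂)))
      where
      rotate : ∀ x y z → (y * z) * x ≡ (x * y) * z
      rotate = solve-∀
    combine : ∀ a b c x y z → (a * y - b * x) * z + (b * z - c * y) * x ≡ y * (a * z - c * x)
    combine = solve-∀
    divisor : (x * y) * z ≡ y * p^ (k ℕ.+ m)
    divisor = trans (reorder x y z) (cong (y *_) (sym (p^-+ k m)))
      where
      reorder : ∀ x y z → (x * y) * z ≡ y * (x * z)
      reorder = solve-∀

  ≈-setoid : Setoid 0ℓ 0ℓ
  ≈-setoid = record
    { Carrier       = QZ p
    ; _≈_           = _≈_
    ; isEquivalence = record { refl = ≈-refl ; sym = ≈-sym ; trans = ≈-trans }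
    }

  ≈-reflexive : ∀ {s t} → s ≡ t → s ≈ t
  ≈-reflexive refl = ≈-refl

  p^-×-lower : ∀ j a k → (p ℕ.^ j) ×ₙ (a /p^ (k ℕ.+ j)) ≈ a /p^ k
  p^-×-lower j a k = ≈-cross (trans (swap (p^ j) a (p^ k)) (cong (a *_) (sym (p^-+ k j))))
    where
    swap : ∀ y a x → (y * a) * x ≡ a * (x * y)
    swap = solve-∀

  ⊕-cong : ∀ {s s′ t t′} → s ≈ s′ → t ≈ t′ → s ⊕ t ≈ s′ ⊕ t′
  ⊕-cong {a /p^ k} {a′ /p^ k′} {b /p^ l} {b′ /p^ l′} h₁ h₂ =
    ≈-intro (∣-respˡ (sym divisor) (∣-respʳ (sym difference)
      (∣m∣n⇒∣m+n (*-mono-∣ (∣-respˡ (p^-+ k k′) (≈-elim h₁)) (∣-refl {p^ l * p^ l′}))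
                  (*-mono-∣ (∣-refl {p^ k * p^ k′}) (∣-respˡ (p^-+ l l′) (≈-elim h₂))))))
    where
    x x′ y y′ : ℤ
    x = p^ k ; x′ = p^ k′ ; y = p^ l ; y′ = p^ l′
    divisor : p^ ((k ℕ.+ l) ℕ.+ (k′ ℕ.+ l′)) ≡ (x * x′) * (y * y′)
    divisor = trans (p^-+ (k ℕ.+ l) (k′ ℕ.+ l′))
                (trans (cong₂ _*_ (p^-+ k l) (p^-+ k′ l′)) (shuffle x y x′ y′))
      where
      shuffle : ∀ x y x′ y′ → (x * y) * (x′ * y′) ≡ (x * x′) * (y * y′)
      shuffle = solve-∀
    difference : (a * y + b * x) * p^ (k′ ℕ.+ l′) - (a′ * y′ + b′ * x′) * p^ (k ℕ.+ l)
               ≡ (a * x′ - a′ * x) * (y * y′) + (x * x′) * (b * y′ - b′ * y)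
    difference =
      trans (cong₂ (λ X Y → (a * y + b * x) * X - (a′ * y′ + b′ * x′) * Y) (p^-+ k′ l′) (p^-+ k l))
            (expand a a′ b b′ x x′ y y′)
      where
      expand : ∀ a a′ b b′ x x′ y y′ → (a * y + b * x) * (x′ * y′) - (a′ * y′ + b′ * x′) * (x * y)
                                      ≡ (a * x′ - a′ * x) * (y * y′) + (x * x′) * (b * y′ - b′ * y)
      expand = solve-∀

  ⊕-identityʳ : ∀ s → s ⊕ 0q p ≈ s
  ⊕-identityʳ (a /p^ k) =
    ≈-cross (trans (simplify a (p^ k)) (cong (λ j → a * p^ j) (sym (ℕ.+-identityʳ k))))
    where
    simplify : ∀ a x → (a * 1ℤ + 0ℤ * x) * x ≡ a * x
    simplify = solve-∀

  neg-cong : ∀ {s t} → s ≈ t → -q_ p s ≈ -q_ p t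
  neg-cong {a /p^ k} {b /p^ l} h = ≈-intro (∣-respʳ (negate a b (p^ k) (p^ l)) (∣m⇒∣-m (≈-elim h)))
    where
    negate : ∀ a b x y → - (a * y - b * x) ≡ (- a) * y - (- b) * x
    negate = solve-∀

  ×-cong : ∀ m {s t} → s ≈ t → m ×ₙ s ≈ m ×ₙ t
  ×-cong m {a /p^ k} {b /p^ l} h =
    ≈-intro (∣-respʳ (distrib (+ m) a b (p^ k) (p^ l)) (∣n⇒∣m*n (+ m) (≈-elim h)))
    where
    distrib : ∀ m a b x y → m * (a * y - b * x) ≡ (m * a) * y - (m * b) * x
    distrib = solve-∀

  ×-assoc : ∀ m l s → m ×ₙ l ×ₙ s ≈ (m ℕ.* l) ×ₙ s
  ×-assoc m l (a /p^ k) =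
    ≈-reflexive (cong (_/p^ k) (trans (sym (ℤ.*-assoc (+ m) (+ l) a)) (cong (_* a) (sym (ℤ.pos-* m l)))))

  ×-identityˡ : ∀ s → 1 ×ₙ s ≈ s
  ×-identityˡ (a /p^ k) = ≈-reflexive (cong (_/p^ k) (ℤ.*-identityˡ a))

  p-×-lower : ∀ a k → p ×ₙ (a /p^ suc k) ≈ a /p^ k
  p-×-lower a k = ≈-cross (trans (swap (+ p) a (p^ k)) (cong (a *_) (sym (p^-suc k))))
    where
    swap : ∀ q a x → (q * a) * x ≡ a * (q * x)
    swap = solve-∀

  killed⇒denominator : ∀ M s → (p ℕ.^ M) ×ₙ s ≈ 0q p → Σ ℤ λ b → s ≈ b /p^ M
  killed⇒denominator M (a /p^ k) h =
    quotient p^k∣p^Ma , ≈-cross (trans (ℤ.*-comm a (p^ M)) (_∣_.equality p^k∣p^Ma))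
    where
    simplify : ∀ u a x → (u * a) * 1ℤ - 0ℤ * x ≡ u * a
    simplify = solve-∀
    p^k∣p^Ma : p^ k ∣ p^ M * a
    p^k∣p^Ma = ∣-respˡ (cong p^_ (ℕ.+-identityʳ k)) (∣-respʳ (simplify (p^ M) a (p^ k)) (≈-elim h))

  private
    lift-1+*≡* : ∀ a b d e → 1 ℕ.+ a ℕ.* b ≡ d ℕ.* e → 1ℤ + + a * + b ≡ + d * + e
    lift-1+*≡* a b d e eq = begin
      1ℤ + + a * + b     ≡⟨ cong (λ t → 1ℤ + t) (ℤ.pos-* a b) ⟨
      + (1 ℕ.+ a ℕ.* b)  ≡⟨ cong +_ eq ⟩
      + (d ℕ.* e)        ≡⟨ ℤ.pos-* d e ⟩
      + d * + e          ∎
      where open ≡-Reasoning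

  inverse-mod-p^ : ∀ {c} → Coprime c p → ∀ k → Σ ℤ λ X → p^ k ∣ + c * X - 1ℤ
  inverse-mod-p^ {c} c⊥p k with coprime-Bézout (coprime-^ c⊥p k)
  ... | Bézout.+- x y eq = + x , divides (+ y) (begin
    + c * + x - 1ℤ           ≡⟨ swap (+ c) (+ x) ⟩
    + x * + c - 1ℤ           ≡⟨ cong (_- 1ℤ) (lift-1+*≡* y (p ℕ.^ k) x c eq) ⟨
    1ℤ + + y * p^ k - 1ℤ     ≡⟨ cancel (+ y * p^ k) ⟩
    + y * p^ k               ∎)
    where
    open ≡-Reasoning
    swap : ∀ c x → c * x - 1ℤ ≡ x * c - 1ℤ
    swap = solve-∀
    cancel : ∀ a → 1ℤ + a - 1ℤ ≡ a
    cancel = solve-∀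
  ... | Bézout.-+ x y eq = - + x , divides (- + y) (begin
    + c * - + x - 1ℤ         ≡⟨ negate (+ c) (+ x) ⟩
    - (1ℤ + + x * + c)       ≡⟨ cong -_ (lift-1+*≡* x c y (p ℕ.^ k) eq) ⟩
    - (+ y * p^ k)           ≡⟨ ℤ.neg-distribˡ-* (+ y) (p^ k) ⟩
    - + y * p^ k             ∎)
    where
    open ≡-Reasoning
    negate : ∀ c x → c * - x - 1ℤ ≡ - (1ℤ + x * c)
    negate = solve-∀

  module _ {n : ℕ} where

    infix  4 _≋_
    infixl 5 _⊕ᵛ_
    infixr 6 _×ᵛ_
    infix  7 _⊗1/p^_
    infixl 8 _⊞_
    infixr 9 _⊡_

    entry : V p n → Fin (n ℕ.+ n) → ℕ → ℤ
    entry x i k = seq (x ! i) k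

    _⊞_ : V p n → V p n → V p n
    _⊞_ = _+V_ p

    _⊡_ : ℤ → V p n → V p n
    c ⊡ x = _·V_ p (fromℤ c) x

    ⊡-∈ : ∀ {X} → IsSubmodule p X → ∀ c {x} → x ∈ X → c ⊡ x ∈ X
    ⊡-∈ X-sub c = IsSubmodule.·∈ X-sub (fromℤ c)

    _⊕ᵛ_ : VQ p n → VQ p n → VQ p n
    _⊕ᵛ_ = _+VQ_ p

    _×ᵛ_ : ℕ → VQ p n → VQ p n
    _×ᵛ_ = _×VQ_ p

    _⊗1/p^_ : V p n → ℕ → VQ p n
    x ⊗1/p^ K = _⊗_ p x (1ℤ /p^ K)

    opaque
      _≋_ : VQ p n → VQ p n → Set
      u ≋ v = ∀ i → u !q i ≈ v !q i

      ≋-intro : ∀ {u v} → (∀ i → u !q i ≈ v !q i) → u ≋ v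
      ≋-intro h = h

      ≋-elim : ∀ {u v} → u ≋ v → ∀ i → u !q i ≈ v !q i
      ≋-elim h = h

    ≈VQ⇒≋ : ∀ {u v} → _≈VQ_ p u v → u ≋ v
    ≈VQ⇒≋ h = ≋-intro (λ i → ≈q⇒≈ (h i))

    ≋⇒≈VQ : ∀ {u v} → u ≋ v → _≈VQ_ p u v
    ≋⇒≈VQ h i = ≈⇒≈q (≋-elim h i)

    ≋-refl : ∀ {u} → u ≋ u
    ≋-refl = ≋-intro (λ _ → ≈-refl)

    ≋-sym : ∀ {u v} → u ≋ v → v ≋ u
    ≋-sym h = ≋-intro (λ i → ≈-sym (≋-elim h i))

    ≋-trans : ∀ {u v w} → u ≋ v → v ≋ w → u ≋ w
    ≋-trans h g = ≋-intro (λ i → ≈-trans (≋-elim h i) (≋-elim g i))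

    ≋-setoid : Setoid 0ℓ 0ℓ
    ≋-setoid = record
      { Carrier       = VQ p n
      ; _≈_           = _≋_
      ; isEquivalence = record { refl = ≋-refl ; sym = ≋-sym ; trans = ≋-trans }
      }

    ⊕ᵛ-cong : ∀ {u u′ v v′} → u ≋ u′ → v ≋ v′ → u ⊕ᵛ v ≋ u′ ⊕ᵛ v′
    ⊕ᵛ-cong h g = ≋-intro (λ i → ⊕-cong (≋-elim h i) (≋-elim g i))

    negᵛ-cong : ∀ {u v} → u ≋ v → -VQ_ p u ≋ -VQ_ p v
    negᵛ-cong h = ≋-intro (λ i → neg-cong (≋-elim h i))

    ×ᵛ-cong : ∀ m {u v} → u ≋ v → m ×ᵛ u ≋ m ×ᵛ v
    ×ᵛ-cong m h = ≋-intro (λ i → ×-cong m (≋-elim h i))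

    ×ᵛ-assoc : ∀ m l u → m ×ᵛ l ×ᵛ u ≋ (m ℕ.* l) ×ᵛ u
    ×ᵛ-assoc m l u = ≋-intro (λ i → ×-assoc m l (u !q i))

    ×ᵛ-≡ : ∀ {m m′} u → m ≡ m′ → m ×ᵛ u ≋ m′ ×ᵛ u
    ×ᵛ-≡ u refl = ≋-refl

    ≋-reflexive : ∀ {u v} → u ≡ v → u ≋ v
    ≋-reflexive refl = ≋-refl

    ×ᵛ-identityˡ : ∀ u → 1 ×ᵛ u ≋ u
    ×ᵛ-identityˡ u = ≋-intro (λ i → ×-identityˡ (u !q i))

    ⊗-scalar : ∀ x a k → _⊗_ p x (a /p^ k) ≋ a ⊡ x ⊗1/p^ k
    ⊗-scalar x a k = ≋-intro (λ i → ≈-reflexive (cong (_/p^ k) (swap (entry x i k) a)))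
      where
      swap : ∀ y a → y * a ≡ (a * y) * 1ℤ
      swap = solve-∀

    ⊗1/p^-zero : 0VQ p ≋ 0V p ⊗1/p^ 0
    ⊗1/p^-zero = ≋-refl

    ⊗1/p^-neg : ∀ x K → -VQ_ p (x ⊗1/p^ K) ≋ (- 1ℤ) ⊡ x ⊗1/p^ K
    ⊗1/p^-neg x K = ≋-intro (λ i → ≈-reflexive (cong (_/p^ K) (negate (entry x i K))))
      where
      negate : ∀ y → - (y * 1ℤ) ≡ (- 1ℤ * y) * 1ℤ
      negate = solve-∀

    -- Both sides have denominator p^(K+L); the numerators differ by
    -- p^L (x_{K+L} - x_K) + p^K (y_{K+L} - y_L).
    ⊗1/p^-+ : ∀ x y K L → x ⊗1/p^ K ⊕ᵛ y ⊗1/p^ L ≋ (p^ L ⊡ x ⊞ p^ K ⊡ y) ⊗1/p^ (K ℕ.+ L)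
    ⊗1/p^-+ x y K L = ≋-intro λ i →
      ∣⇒≈ (K ℕ.+ L) (∣-respˡ (sym (p^-+ K L))
        (∣-respʳ (difference (entry x i K) (entry x i (K ℕ.+ L)) (entry y i L) (entry y i (K ℕ.+ L)) (p^ K) (p^ L))
          (∣m⇒∣-m (∣m∣n⇒∣m+n (*-mono-∣ (seq-compat (x ! i) (ℕ.m≤m+n K L)) (∣-refl {p^ L}))
                             (*-mono-∣ (∣-refl {p^ K}) (seq-compat (y ! i) (ℕ.m≤n+m L K)))))))
      where
      difference : ∀ xK xKL yL yKL u v →
        - ((xKL - xK) * v + u * (yKL - yL)) ≡ (xK * 1ℤ * v + yL * 1ℤ * u) - (v * xKL + u * yKL) * 1ℤ
      difference = solve-∀

    ⊗1/p^-killed : ∀ x K → (p ℕ.^ K) ×ᵛ x ⊗1/p^ K ≋ 0VQ p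
    ⊗1/p^-killed x K = ≋-intro λ i →
      ≈-intro (∣-respˡ (cong p^_ (sym (ℕ.+-identityʳ K)))
                       (∣-respʳ (shift (p^ K) (entry x i K)) (∣m⇒∣m*n (entry x i K) (∣-refl {p^ K}))))
      where
      shift : ∀ u y → u * y ≡ (u * (y * 1ℤ)) * 1ℤ - 0ℤ * u
      shift = solve-∀

    ⊗1/p^-divide : ∀ j c c⁻¹ K x → p^ (K ℕ.+ j) ∣ + c * c⁻¹ - 1ℤ →
                   (p ℕ.^ j ℕ.* c) ×ᵛ c⁻¹ ⊡ x ⊗1/p^ (K ℕ.+ j) ≋ x ⊗1/p^ K
    ⊗1/p^-divide j c c⁻¹ K x cc⁻¹≡1 = ≋-intro λ i → begin
      (p ℕ.^ j ℕ.* c) ×ₙ ((c⁻¹ * xKj i * 1ℤ) /p^ (K ℕ.+ j))  ≈⟨ ≈-reflexive (cong (_/p^ (K ℕ.+ j)) (reshape i)) ⟩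
      (p ℕ.^ j) ×ₙ ((+ c * c⁻¹ * xKj i) /p^ (K ℕ.+ j))        ≈⟨ p^-×-lower j (+ c * c⁻¹ * xKj i) K ⟩
      (+ c * c⁻¹ * xKj i) /p^ K                               ≈⟨ ∣⇒≈ K (cc⁻¹x≡x i) ⟩
      (xK i * 1ℤ) /p^ K                                       ∎
      where
      open SetoidReasoning ≈-setoid
      K≤K+j : K ≤ K ℕ.+ j
      K≤K+j = ℕ.m≤m+n K j
      xK xKj : Fin (n ℕ.+ n) → ℤ
      xK i = entry x i K
      xKj i = entry x i (K ℕ.+ j)
      reshape : ∀ i → + (p ℕ.^ j ℕ.* c) * (c⁻¹ * xKj i * 1ℤ) ≡ p^ j * (+ c * c⁻¹ * xKj i)
      reshape i =
        trans (cong (_* (c⁻¹ * xKj i * 1ℤ)) (ℤ.pos-* (p ℕ.^ j) c)) (regroup (p^ j) (+ c) c⁻¹ (xKj i))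
        where
        regroup : ∀ u c d y → (u * c) * (d * y * 1ℤ) ≡ u * (c * d * y)
        regroup = solve-∀
      cc⁻¹x≡x : ∀ i → p^ K ∣ + c * c⁻¹ * xKj i - xK i * 1ℤ
      cc⁻¹x≡x i = ∣-respʳ (split (+ c * c⁻¹) (xKj i) (xK i))
        (∣m∣n⇒∣m+n (∣m⇒∣m*n (xKj i) (∣-trans (p^-mono K≤K+j) cc⁻¹≡1)) (seq-compat (x ! i) K≤K+j))
        where
        split : ∀ e y z → (e - 1ℤ) * y + (y - z) ≡ e * y - z * 1ℤ
        split = solve-∀

    -- Pure tensors in V ⊗ ℚ_p/ℤ_p

    PureTensorIn : Pred (V p n) 0ℓ → Pred (VQ p n) 0ℓ
    PureTensorIn X u = Σ ℕ λ K → Σ (V p n) λ x → x ∈ X × u ≋ x ⊗1/p^ K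

    PureTensorIn-resp : ∀ {X u v} → u ≋ v → PureTensorIn X u → PureTensorIn X v
    PureTensorIn-resp u≋v (K , x , x∈X , u≋x) = K , x , x∈X , ≋-trans (≋-sym u≋v) u≋x

    PureTensorIn⇒TensorQZ : ∀ {X} → PureTensorIn X ⊆ TensorQZ p X
    PureTensorIn⇒TensorQZ (K , x , x∈X , u≋x) =
      1 , (λ _ → x) , (λ _ → 1ℤ /p^ K) , (λ _ → x∈X) ,
      ≋⇒≈VQ (≋-trans u≋x (≋-intro (λ i → ≈-sym (⊕-identityʳ ((x ⊗1/p^ K) !q i)))))

    module _ {X : Pred (V p n) 0ℓ} (X-sub : IsSubmodule p X) where
      open IsSubmodule X-sub

      PureTensorIn-+ : ∀ {u v} → PureTensorIn X u → PureTensorIn X v → PureTensorIn X (u ⊕ᵛ v)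
      PureTensorIn-+ (K , x , x∈X , u≋) (L , y , y∈X , v≋) =
        K ℕ.+ L , p^ L ⊡ x ⊞ p^ K ⊡ y , +∈ (⊡-∈ X-sub (p^ L) x∈X) (⊡-∈ X-sub (p^ K) y∈X) ,
        ≋-trans (⊕ᵛ-cong u≋ v≋) (⊗1/p^-+ x y K L)

      PureTensorIn-neg : ∀ {u} → PureTensorIn X u → PureTensorIn X (-VQ_ p u)
      PureTensorIn-neg (K , x , x∈X , u≋) =
        K , (- 1ℤ) ⊡ x , ⊡-∈ X-sub (- 1ℤ) x∈X , ≋-trans (negᵛ-cong u≋) (⊗1/p^-neg x K)

      sum⇒PureTensorIn : ∀ {m} (xs : Fin m → V p n) (ts : Fin m → QZ p) → (∀ j → xs j ∈ X) →
                         PureTensorIn X (sumVQ p (λ j → _⊗_ p (xs j) (ts j)))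
      sum⇒PureTensorIn {zero}  xs ts xs∈X = 0 , 0V p , zero∈ , ⊗1/p^-zero
      sum⇒PureTensorIn {suc m} xs ts xs∈X =
        PureTensorIn-+ (ex (ts zero) , num (ts zero) ⊡ xs zero , ⊡-∈ X-sub (num (ts zero)) (xs∈X zero) ,
                        ⊗-scalar (xs zero) (num (ts zero)) (ex (ts zero)))
                       (sum⇒PureTensorIn (λ j → xs (suc j)) (λ j → ts (suc j)) (λ j → xs∈X (suc j)))

      TensorQZ⇒PureTensorIn : TensorQZ p X ⊆ PureTensorIn X
      TensorQZ⇒PureTensorIn {u} (m , xs , ts , xs∈X , u≈) =
        PureTensorIn-resp (≋-sym (≈VQ⇒≋ {u} u≈)) (sum⇒PureTensorIn xs ts xs∈X)

      TensorQZ-isSubgroup : IsSubgroup p (TensorQZ p X)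
      TensorQZ-isSubgroup = record
        { resp  = λ {u} {v} u≈v → via-pure {u} (PureTensorIn-resp (≈VQ⇒≋ {u} {v} u≈v))
        ; zero∈ = 0 , (λ ()) , (λ ()) , (λ ()) , ≋⇒≈VQ (≋-refl {0VQ p})
        ; +∈    = λ {u} {v} u∈ v∈ → PureTensorIn⇒TensorQZ
                    (PureTensorIn-+ (TensorQZ⇒PureTensorIn {u} u∈) (TensorQZ⇒PureTensorIn {v} v∈))
        ; -∈    = λ {u} → via-pure {u} PureTensorIn-neg
        }
        where
        via-pure : ∀ {u v} → (PureTensorIn X u → PureTensorIn X v) → u ∈ TensorQZ p X → v ∈ TensorQZ p X
        via-pure {u} f u∈ = PureTensorIn⇒TensorQZ (f (TensorQZ⇒PureTensorIn {u} u∈))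

      -- Write m + 1 = p^j c with p ∤ c and invert c modulo p^(K+j).
      PureTensorIn-divide : Prime p → ∀ m {u} → PureTensorIn X u →
                            Σ (VQ p n) λ w → PureTensorIn X w × suc m ×ᵛ w ≋ u
      PureTensorIn-divide p-prime m {u} (K , x , x∈X , u≋x) =
        let (j , c , 1+m≡p^j*c , p∤c) = split-p-power p-prime (suc m)
            (c⁻¹ , cc⁻¹≡1)           = inverse-mod-p^ (∤⇒coprime p-prime p∤c) (K ℕ.+ j)
            w                        = c⁻¹ ⊡ x ⊗1/p^ (K ℕ.+ j)
        in w , (K ℕ.+ j , c⁻¹ ⊡ x , ⊡-∈ X-sub c⁻¹ x∈X , ≋-refl) , (begin
          suc m ×ᵛ w              ≈⟨ ×ᵛ-≡ w 1+m≡p^j*c ⟩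
          (p ℕ.^ j ℕ.* c) ×ᵛ w    ≈⟨ ⊗1/p^-divide j c c⁻¹ K x cc⁻¹≡1 ⟩
          x ⊗1/p^ K               ≈⟨ ≋-sym u≋x ⟩
          u                       ∎)
        where open SetoidReasoning ≋-setoid

      TensorQZ-isDivisible : Prime p → IsDivisible p (TensorQZ p X)
      TensorQZ-isDivisible p-prime m u u∈ =
        let (w , w-pure , m+1×w≋u) = PureTensorIn-divide p-prime m (TensorQZ⇒PureTensorIn {u} u∈)
        in w , PureTensorIn⇒TensorQZ w-pure , ≋⇒≈VQ m+1×w≋u

    -- Direct summands

    divide-p^ᵛ : ∀ L x → (∀ i → p^ L ∣ entry x i L) → Σ (V p n) λ r → _≈V_ p x (p^ L ⊡ r)
    divide-p^ᵛ L x p^L∣x = vec (λ i → proj₁ (divide-p^ L (x ! i) (p^L∣x i))) ,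
                           (λ i → proj₂ (divide-p^ L (x ! i) (p^L∣x i)))

    ⊗1/p^-≋⇒∣ : ∀ v z M K → v ⊗1/p^ M ≋ z ⊗1/p^ K →
                ∀ i → p^ (M ℕ.+ K) ∣ entry (p^ K ⊡ v ⊞ (- p^ M) ⊡ z) i (M ℕ.+ K)
    ⊗1/p^-≋⇒∣ v z M K h i =
      ∣-respʳ (combine (entry v i M) (entry v i (M ℕ.+ K)) (entry z i K) (entry z i (M ℕ.+ K)) (p^ M) (p^ K))
        (∣m∣n⇒∣m-n (∣m∣n⇒∣m+n (≈-elim (≋-elim h i)) (∣-respˡ (sym (p^-+ M K)) v-step))
                   (∣-respˡ (sym (p^-+ M K)) z-step))
      where
      v-step : p^ M * p^ K ∣ (entry v i (M ℕ.+ K) - entry v i M) * p^ K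
      v-step = *-mono-∣ (seq-compat (v ! i) (ℕ.m≤m+n M K)) (∣-refl {p^ K})
      z-step : p^ M * p^ K ∣ p^ M * (entry z i (M ℕ.+ K) - entry z i K)
      z-step = *-mono-∣ (∣-refl {p^ M}) (seq-compat (z ! i) (ℕ.m≤n+m K M))
      combine : ∀ vM vMK zK zMK u w →
        ((vM * 1ℤ) * w - (zK * 1ℤ) * u + (vMK - vM) * w) - u * (zMK - zK) ≡ w * vMK + (- u) * zMK
      combine = solve-∀

    module DirectSummand {Z C : Pred (V p n) 0ℓ} (Z-sub : IsSubmodule p Z) (C-sub : IsSubmodule p C)
      (decompose : ∀ v → Σ (V p n) λ z → Σ (V p n) λ c → z ∈ Z × c ∈ C × _≈V_ p v (z ⊞ c))
      (Z∩C≈0 : ∀ v → v ∈ Z → v ∈ C → _≈V_ p v (0V p)) where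

      private
        module Z = IsSubmodule Z-sub
        module C = IsSubmodule C-sub

      C-part-unique : ∀ {z₁ z₂ c₁ c₂} → z₁ ∈ Z → z₂ ∈ Z → c₁ ∈ C → c₂ ∈ C →
                      _≈V_ p (z₁ ⊞ c₁) (z₂ ⊞ c₂) → _≈V_ p c₁ c₂
      C-part-unique {z₁} {z₂} {c₁} {c₂} z₁∈Z z₂∈Z c₁∈C c₂∈C z₁+c₁≈z₂+c₂ i k =
        ∣-respʳ (drop-zero (entry c₁ i k) (entry c₂ i k)) (Z∩C≈0 d (Z.resp e≈d e∈Z) d∈C i k)
        where
        d e : V p n
        d = c₁ ⊞ (- 1ℤ) ⊡ c₂
        e = z₂ ⊞ (- 1ℤ) ⊡ z₁
        d∈C : d ∈ C
        d∈C = C.+∈ c₁∈C (⊡-∈ C-sub (- 1ℤ) c₂∈C)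
        e∈Z : e ∈ Z
        e∈Z = Z.+∈ z₂∈Z (⊡-∈ Z-sub (- 1ℤ) z₁∈Z)
        e≈d : _≈V_ p e d
        e≈d i k = ∣-respʳ (swap (entry z₁ i k) (entry z₂ i k) (entry c₁ i k) (entry c₂ i k))
                          (∣m⇒∣-m (z₁+c₁≈z₂+c₂ i k))
          where
          swap : ∀ z₁ z₂ c₁ c₂ → - ((z₁ + c₁) - (z₂ + c₂)) ≡ (z₂ + (- 1ℤ) * z₁) - (c₁ + (- 1ℤ) * c₂)
          swap = solve-∀
        drop-zero : ∀ a b → (a + (- 1ℤ) * b) - 0ℤ ≡ a - b
        drop-zero = solve-∀

      -- For x = p^K v - p^M z ∈ p^(M+K) V, the C-components of its two
      -- decompositions give p^K c ∈ p^(M+K) V.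
      C-part-divisible : ∀ {v ζ c} M → ζ ∈ Z → c ∈ C → _≈V_ p v (ζ ⊞ c) →
                         PureTensorIn Z (v ⊗1/p^ M) → ∀ i → p^ M ∣ entry c i M
      C-part-divisible {v} {ζ} {c} M ζ∈Z c∈C v≈ζ+c (K , z , z∈Z , v≋z) i =
        ∣-seq-lower (c ! i) (ℕ.m≤m+n M K)
          (∣-cancel-p^ K (∣-respˡ (trans (p^-+ M K) (ℤ.*-comm (p^ M) (p^ K))) p^L∣p^KcL))
        where
        L : ℕ
        L = M ℕ.+ K
        x : V p n
        x = p^ K ⊡ v ⊞ (- p^ M) ⊡ z
        r : V p n
        r = proj₁ (divide-p^ᵛ L x (⊗1/p^-≋⇒∣ v z M K v≋z))
        x≈p^Lr : _≈V_ p x (p^ L ⊡ r)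
        x≈p^Lr = proj₂ (divide-p^ᵛ L x (⊗1/p^-≋⇒∣ v z M K v≋z))
        ζr cr : V p n
        ζr = proj₁ (decompose r)
        cr = proj₁ (proj₂ (decompose r))
        ζr∈Z : ζr ∈ Z
        ζr∈Z = proj₁ (proj₂ (proj₂ (decompose r)))
        cr∈C : cr ∈ C
        cr∈C = proj₁ (proj₂ (proj₂ (proj₂ (decompose r))))
        r≈ζr+cr : _≈V_ p r (ζr ⊞ cr)
        r≈ζr+cr = proj₂ (proj₂ (proj₂ (proj₂ (decompose r))))
        decomposition : _≈V_ p ((p^ K ⊡ ζ ⊞ (- p^ M) ⊡ z) ⊞ p^ K ⊡ c) (p^ L ⊡ ζr ⊞ p^ L ⊡ cr)
        decomposition i k =
          ∣-respʳ (regroup (entry v i k) (entry ζ i k) (entry c i k) (entry z i k)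
                           (entry r i k) (entry ζr i k) (entry cr i k) (p^ K) (p^ M) (p^ L))
            (∣m∣n⇒∣m+n (∣m∣n⇒∣m+n (∣n⇒∣m*n (- p^ K) (v≈ζ+c i k)) (x≈p^Lr i k))
                       (∣n⇒∣m*n (p^ L) (r≈ζr+cr i k)))
          where
          regroup : ∀ v ζ c z r ζr cr u w P →
            (- u) * (v - (ζ + c)) + ((u * v + (- w) * z) - P * r) + P * (r - (ζr + cr))
            ≡ ((u * ζ + (- w) * z) + u * c) - (P * ζr + P * cr)
          regroup = solve-∀
        p^Kc≈p^Lcr : _≈V_ p (p^ K ⊡ c) (p^ L ⊡ cr)
        p^Kc≈p^Lcr = C-part-unique (Z.+∈ (⊡-∈ Z-sub (p^ K) ζ∈Z) (⊡-∈ Z-sub (- p^ M) z∈Z)) (⊡-∈ Z-sub (p^ L) ζr∈Z)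
                                   (⊡-∈ C-sub (p^ K) c∈C) (⊡-∈ C-sub (p^ L) cr∈C) decomposition
        p^L∣p^KcL : p^ L ∣ p^ K * entry c i L
        p^L∣p^KcL = ∣-respʳ (cancel (p^ K * entry c i L) (p^ L * entry cr i L))
                            (∣m∣n⇒∣m+n (p^Kc≈p^Lcr i L) (∣m⇒∣m*n (entry cr i L) (∣-refl {p^ L})))
          where
          cancel : ∀ a b → (a - b) + b ≡ a
          cancel = solve-∀

      ⊗1/p^-closed : ∀ v e → (∀ N → PureTensorIn Z (v ⊗1/p^ (N ℕ.+ e))) → v ∈ Z
      ⊗1/p^-closed v e pure = Z.resp ζ≈v ζ∈Z
        where
        ζ c : V p n
        ζ = proj₁ (decompose v)
        c = proj₁ (proj₂ (decompose v))
        ζ∈Z : ζ ∈ Z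
        ζ∈Z = proj₁ (proj₂ (proj₂ (decompose v)))
        c∈C : c ∈ C
        c∈C = proj₁ (proj₂ (proj₂ (proj₂ (decompose v))))
        v≈ζ+c : _≈V_ p v (ζ ⊞ c)
        v≈ζ+c = proj₂ (proj₂ (proj₂ (proj₂ (decompose v))))
        c≈0 : ∀ i N → p^ N ∣ entry c i N
        c≈0 i N = ∣-seq-lower (c ! i) (ℕ.m≤m+n N e)
          (∣-trans (p^-mono (ℕ.m≤m+n N e)) (C-part-divisible {v} (N ℕ.+ e) ζ∈Z c∈C v≈ζ+c (pure N) i))
        ζ≈v : _≈V_ p ζ v
        ζ≈v i k = ∣-respʳ (rearrange (entry v i k) (entry ζ i k) (entry c i k))
                          (∣m∣n⇒∣m-n (∣m⇒∣-m (v≈ζ+c i k)) (c≈0 i k))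
          where
          rearrange : ∀ v ζ c → - (v - (ζ + c)) - c ≡ ζ - v
          rearrange = solve-∀

    -- Divisible subgroups of V ⊗ ℚ_p/ℤ_p

    module Tower {D : Pred (VQ p n) 0ℓ} (D-divisible : IsDivisible p D) {u} (u∈D : u ∈ D) where

      root : ∀ {w} → w ∈ D → Σ (VQ p n) λ w′ → w′ ∈ D × p ×ᵛ w′ ≋ w
      root {w} w∈D with D-divisible (ℕ.pred p) w w∈D
      ... | w′ , w′∈D , p×w′≈w = w′ , w′∈D , ≋-trans (×ᵛ-≡ w′ (sym (ℕ.suc-pred p))) (≈VQ⇒≋ p×w′≈w)

      tower : ℕ → Σ (VQ p n) (_∈ D)
      tower zero    = u , u∈D
      tower (suc N) = proj₁ (root (proj₂ (tower N))) , proj₁ (proj₂ (root (proj₂ (tower N))))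

      w : ℕ → VQ p n
      w N = proj₁ (tower N)

      w∈D : ∀ N → w N ∈ D
      w∈D N = proj₂ (tower N)

      p×w-suc : ∀ N → p ×ᵛ w (suc N) ≋ w N
      p×w-suc N = proj₂ (proj₂ (root (w∈D N)))

      p^×w : ∀ j N → (p ℕ.^ j) ×ᵛ w (j ℕ.+ N) ≋ w N
      p^×w zero    N = ×ᵛ-identityˡ (w N)
      p^×w (suc j) N = begin
        (p ℕ.* p ℕ.^ j) ×ᵛ w (suc j ℕ.+ N)     ≈⟨ ×ᵛ-≡ (w (suc j ℕ.+ N)) (ℕ.*-comm p (p ℕ.^ j)) ⟩
        (p ℕ.^ j ℕ.* p) ×ᵛ w (suc j ℕ.+ N)     ≈⟨ ×ᵛ-assoc (p ℕ.^ j) p (w (suc j ℕ.+ N)) ⟨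
        (p ℕ.^ j) ×ᵛ p ×ᵛ w (suc (j ℕ.+ N))    ≈⟨ ×ᵛ-cong (p ℕ.^ j) (p×w-suc (j ℕ.+ N)) ⟩
        (p ℕ.^ j) ×ᵛ w (j ℕ.+ N)               ≈⟨ p^×w j N ⟩
        w N                                    ∎
        where open SetoidReasoning ≋-setoid

      module _ (e : ℕ) (u-killed : (p ℕ.^ e) ×ᵛ u ≋ 0VQ p) where

        w-killed : ∀ N → (p ℕ.^ (N ℕ.+ e)) ×ᵛ w N ≋ 0VQ p
        w-killed N = begin
          (p ℕ.^ (N ℕ.+ e)) ×ᵛ w N
            ≈⟨ ×ᵛ-≡ (w N) (trans (ℕ.^-distribˡ-+-* p N e) (ℕ.*-comm (p ℕ.^ N) (p ℕ.^ e))) ⟩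
          (p ℕ.^ e ℕ.* p ℕ.^ N) ×ᵛ w N
            ≈⟨ ×ᵛ-assoc (p ℕ.^ e) (p ℕ.^ N) (w N) ⟨
          (p ℕ.^ e) ×ᵛ (p ℕ.^ N) ×ᵛ w N
            ≈⟨ ×ᵛ-cong (p ℕ.^ e) (≋-reflexive (cong (λ m → (p ℕ.^ N) ×ᵛ w m) (sym (ℕ.+-identityʳ N)))) ⟩
          (p ℕ.^ e) ×ᵛ (p ℕ.^ N) ×ᵛ w (N ℕ.+ 0)
            ≈⟨ ×ᵛ-cong (p ℕ.^ e) (p^×w N 0) ⟩
          (p ℕ.^ e) ×ᵛ u
            ≈⟨ u-killed ⟩
          0VQ p
            ∎
          where open SetoidReasoning ≋-setoid

        numerator : ℕ → Fin (n ℕ.+ n) → ℤ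
        numerator N i = proj₁ (killed⇒denominator (N ℕ.+ e) (w N !q i) (≋-elim (w-killed N) i))

        w≈numerator : ∀ N i → w N !q i ≈ numerator N i /p^ (N ℕ.+ e)
        w≈numerator N i = proj₂ (killed⇒denominator (N ℕ.+ e) (w N !q i) (≋-elim (w-killed N) i))

        numerator-compat : ∀ i N → p^ N ∣ numerator (suc N) i - numerator N i
        numerator-compat i N = ∣-trans (p^-mono (ℕ.m≤m+n N e)) (≈⇒∣ (N ℕ.+ e) (begin
          numerator (suc N) i /p^ (N ℕ.+ e)              ≈⟨ p-×-lower (numerator (suc N) i) (N ℕ.+ e) ⟨
          p ×ₙ (numerator (suc N) i /p^ suc (N ℕ.+ e))   ≈⟨ ×-cong p (w≈numerator (suc N) i) ⟨
          p ×ₙ (w (suc N) !q i)                          ≈⟨ ≋-elim (p×w-suc N) i ⟩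
          w N !q i                                       ≈⟨ w≈numerator N i ⟩
          numerator N i /p^ (N ℕ.+ e)                    ∎))
          where open SetoidReasoning ≈-setoid

        limit : V p n
        limit = vec (λ i → mkZp (λ N → numerator N i) (numerator-compat i))

        w≋limit : ∀ N → w N ≋ limit ⊗1/p^ (N ℕ.+ e)
        w≋limit N = ≋-intro λ i → begin
          w N !q i
            ≈⟨ ≋-elim (p^×w e N) i ⟨
          (p ℕ.^ e) ×ₙ (w (e ℕ.+ N) !q i)
            ≈⟨ ×-cong (p ℕ.^ e) (w≈numerator (e ℕ.+ N) i) ⟩
          (p ℕ.^ e) ×ₙ (numerator (e ℕ.+ N) i /p^ (e ℕ.+ N ℕ.+ e))
            ≈⟨ p^-×-lower e (numerator (e ℕ.+ N) i) (e ℕ.+ N) ⟩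
          numerator (e ℕ.+ N) i /p^ (e ℕ.+ N)
            ≈⟨ ≈-reflexive (cong (λ m → numerator m i /p^ m) (ℕ.+-comm e N)) ⟩
          numerator (N ℕ.+ e) i /p^ (N ℕ.+ e)
            ≈⟨ ≈-reflexive (cong (_/p^ (N ℕ.+ e)) (ℤ.*-identityʳ (numerator (N ℕ.+ e) i))) ⟨
          (numerator (N ℕ.+ e) i * 1ℤ) /p^ (N ℕ.+ e)
            ∎
          where open SetoidReasoning ≈-setoid

    ∩-isSubmodule : ∀ {X Y : Pred (V p n) 0ℓ} →
                    IsSubmodule p X → IsSubmodule p Y → IsSubmodule p (_∩_ p X Y)
    ∩-isSubmodule X-sub Y-sub = record
      { resp  = λ {u} {v} u≈v (u∈X , u∈Y) → X.resp {u} {v} u≈v u∈X , Y.resp {u} {v} u≈v u∈Y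
      ; zero∈ = X.zero∈ , Y.zero∈
      ; +∈    = λ {u} {v} (u∈X , u∈Y) (v∈X , v∈Y) → X.+∈ {u} {v} u∈X v∈X , Y.+∈ {u} {v} u∈Y v∈Y
      ; ·∈    = λ a {v} (v∈X , v∈Y) → X.·∈ a {v} v∈X , Y.·∈ a {v} v∈Y
      }
      where
      module X = IsSubmodule X-sub
      module Y = IsSubmodule Y-sub

    TensorQZ-mono : ∀ {X Y : Pred (V p n) 0ℓ} → X ⊆ Y → TensorQZ p X ⊆ TensorQZ p Y
    TensorQZ-mono X⊆Y {u} (m , xs , ts , xs∈X , u≈) = m , xs , ts , (λ j → X⊆Y (xs∈X j)) , u≈

    summand-⊗1/p^-closed : ∀ {Z} → IsDirectSummand p Z →
                           ∀ v e → (∀ N → PureTensorIn Z (v ⊗1/p^ (N ℕ.+ e))) → v ∈ Z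
    summand-⊗1/p^-closed (Z-sub , C , C-sub , decompose , Z∩C≈0) =
      DirectSummand.⊗1/p^-closed Z-sub C-sub decompose Z∩C≈0

    divisible⊆TensorQZ-∩ : ∀ {Z W : Pred (V p n) 0ℓ} {D : Pred (VQ p n) 0ℓ} →
      IsDirectSummand p Z → IsDirectSummand p W →
      D ⊆ _∩_ p (TensorQZ p Z) (TensorQZ p W) → IsDivisible p D → D ⊆ TensorQZ p (_∩_ p Z W)
    divisible⊆TensorQZ-∩ {Z} {W} Z-summand W-summand D⊆S D-divisible {u} u∈D =
      PureTensorIn⇒TensorQZ {_∩_ p Z W}
        (e , limit e u-killed , (limit∈ Z-summand proj₁ , limit∈ W-summand proj₂) , w≋limit e u-killed 0)
      where
      open Tower D-divisible u∈D
      u-pure : PureTensorIn Z u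
      u-pure = TensorQZ⇒PureTensorIn (proj₁ Z-summand) {u} (proj₁ (D⊆S u∈D))
      e : ℕ
      e = proj₁ u-pure
      z : V p n
      z = proj₁ (proj₂ u-pure)
      u-killed : (p ℕ.^ e) ×ᵛ u ≋ 0VQ p
      u-killed = ≋-trans (×ᵛ-cong (p ℕ.^ e) (proj₂ (proj₂ (proj₂ u-pure)))) (⊗1/p^-killed z e)
      limit∈ : ∀ {X : Pred (V p n) 0ℓ} → IsDirectSummand p X →
               (∀ {v} → v ∈ _∩_ p (TensorQZ p Z) (TensorQZ p W) → v ∈ TensorQZ p X) → limit e u-killed ∈ X
      limit∈ X-summand select = summand-⊗1/p^-closed X-summand (limit e u-killed) e λ N →
        PureTensorIn-resp (w≋limit e u-killed N)
          (TensorQZ⇒PureTensorIn (proj₁ X-summand) {w N} (select {w N} (D⊆S (w∈D N))))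

proposition5p1 : (p : ℕ) → Prime p → (n : ℕ) → (Z W : Pred (V p n) 0ℓ) →
    IsMaxIsotropicSummand p n Z → IsMaxIsotropicSummand p n W →
    IsMaxDivisibleSubgroupOf p (_∩_ p (TensorQZ p Z) (TensorQZ p W)) (TensorQZ p (_∩_ p Z W))
proposition5p1 p p-prime n Z W (Z-summand , _ , _) (W-summand , _ , _) =
  TensorQZ-isSubgroup p Z∩W-sub ,
  (λ {u} u∈R → TensorQZ-mono p {X = _∩_ p Z W} {Y = Z} proj₁ {u} u∈R ,
               TensorQZ-mono p {X = _∩_ p Z W} {Y = W} proj₂ {u} u∈R) ,
  TensorQZ-isDivisible p Z∩W-sub p-prime ,
  λ _ _ D⊆S D-divisible → divisible⊆TensorQZ-∩ p Z-summand W-summand D⊆S D-divisible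
  where
  instance
    p≢0 : ℕ.NonZero p
    p≢0 = prime⇒nonZero p-prime
  Z∩W-sub : IsSubmodule p (_∩_ p Z W)
  Z∩W-sub = ∩-isSubmodule p (proj₁ Z-summand) (proj₁ W-summand)
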